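{- Let $\mathcal{R}=(V,R)$ be the random graph, $\mathcal{K}\subset\mathrm{Aut}(\mathcal{R})$ compact, $M\subset V$ finite and $\tau:M\to\{0,1\}$ a function. Then there exists a vertex $v$ that is a splitting point for $M$ and $\mathcal{K}$, realizes $\tau$, and satisfies $d_{\mathcal{K}}(v,M)>3$.
   Context: The random graph $\mathcal{R}=(V,R)$ is the unique countable graph such that for every pair of finite disjoint $A,B\subset V$ there is $v$ with $xRv$ for $x\in A$ and $\neg(yRv)$ for $y\in B$; $\mathrm{Aut}(\mathcal{R})$ carries the topology of pointwise convergence. A vertex $v$ realizes $\tau:M\to\{0,1\}$ if for every $w\in M$: $wRv\iff\tau(w)=1$. A vertex $v$ is a splitting point for $M$ and $\mathcal{K}$ if for all $h,h'\in\mathcal{K}$ with $h|_M\neq h'|_M$ we have $h(v)\neq h'(v)$ and $h^{ -1}(v)\neq h'^{ -1}(v)$. Define a graph $E$ on $V$ by $xEy$ iff there is $h\in\mathcal{K}$ with $h(x)=y$ or $h^{ -1}(x)=y$; $d_{\mathcal{K}}(x,y)$ is the length of the shortest $E$-path from $x$ to $y$ ($\infty$ if none), and $d_{\mathcal{K}}(v,M)=\min\{d_{\mathcal{K}}(v,y):y\in M\}$. -}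

module Defs where

open import Data.Nat using (ℕ; zero; suc; _≤_; _<_)
open import Data.Bool using (Bool; true; false)
open import Data.List using (List)
open import Data.List.Membership.Propositional using (_∈_)
open import Data.List.Relation.Unary.Any using (Any)
open import Data.Product using (Σ; ∃; _×_; _,_)
open import Data.Sum using (_⊎_)
open import Data.Empty using (⊥)
open import Relation.Nullary using (¬_)
open import Relation.Binary.PropositionalEquality using (_≡_; _≢_)

Graph : Set
Graph = ℕ → ℕ → Bool

-- R is (isomorphic to) the random graph: a simple graph (symmetric, irreflexive)
-- with the extension property for all finite disjoint A, B.
record IsRandomGraph (R : Graph) : Set where
  field
    symmetric   : ∀ x y → R x y ≡ R y x
    irreflexive : ∀ x → R x x ≡ false
    extension   : (A B : List ℕ) → (∀ x → x ∈ A → x ∈ B → ⊥) →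
                  ∃ λ v → (∀ x → x ∈ A → R x v ≡ true) × (∀ y → y ∈ B → R y v ≡ false)

record Aut (R : Graph) : Set where
  field
    fun     : ℕ → ℕ
    inv     : ℕ → ℕ
    inv-fun : ∀ x → inv (fun x) ≡ x
    fun-inv : ∀ x → fun (inv x) ≡ x
    pres    : ∀ x y → R (fun x) (fun y) ≡ R x y
open Aut public

-- Topology of pointwise convergence on Aut(R): U is open iff every h ∈ U has a
-- basic neighbourhood {h' : h' agrees with h on a finite set F} contained in U.
IsOpen : {R : Graph} → (Aut R → Set) → Set
IsOpen {R} U = ∀ h → U h → ∃ λ (F : List ℕ) →
  ∀ (h' : Aut R) → (∀ x → x ∈ F → fun h' x ≡ fun h x) → U h'

IsCompact : {R : Graph} → (Aut R → Set) → Set₁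
IsCompact {R} K = ∀ {I : Set} (U : I → Aut R → Set) → (∀ i → IsOpen (U i)) →
  (∀ h → K h → ∃ λ i → U i h) →
  ∃ λ (is : List I) → ∀ h → K h → Any (λ i → U i h) is

-- v realizes τ : M → {0,1} (τ given as a Bool-valued function, only its values on M matter).
Realizes : Graph → List ℕ → (ℕ → Bool) → ℕ → Set
Realizes R M τ v = ∀ w → w ∈ M → R w v ≡ τ w

SplittingPoint : {R : Graph} → (Aut R → Set) → List ℕ → ℕ → Set
SplittingPoint {R} K M v = ∀ (h h' : Aut R) → K h → K h' →
  ¬ (∀ x → x ∈ M → fun h x ≡ fun h' x) →
  (fun h v ≢ fun h' v) × (inv h v ≢ inv h' v)

E : {R : Graph} → (Aut R → Set) → ℕ → ℕ → Set
E {R} K x y = ∃ λ (h : Aut R) → K h × ((fun h x ≡ y) ⊎ (inv h x ≡ y))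

data Walk {R : Graph} (K : Aut R → Set) : ℕ → ℕ → ℕ → Set where
  here : ∀ x → Walk K zero x x
  step : ∀ {n x y z} → E K x y → Walk K n y z → Walk K (suc n) x z

-- d_K(x,y) ≤ n  iff there is an E-walk of length ≤ n from x to y
-- (a shortest walk is a path, so this matches the shortest-path distance).
DistLe : {R : Graph} → (Aut R → Set) → ℕ → ℕ → ℕ → Set
DistLe K n x y = ∃ λ m → m ≤ n × Walk K m x y

-- d_K(v, M) > n  (min over y ∈ M; vacuous/∞ if M is empty or no path exists).
DistToSetGt : {R : Graph} → (Aut R → Set) → ℕ → List ℕ → ℕ → Set
DistToSetGt K v M n = ∀ y → y ∈ M → ¬ DistLe K n v y

module Submission where

-- Compactness of K makes every finite set F have a finite orbit Orb F
-- containing h(x) and h⁻¹(x) for all h ∈ K, x ∈ F; hence the E-ball of radius n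
-- around M is contained in a finite set Ball M n.  To every point p of
-- P = M ∪ Orb M we attach a private neighbour aₚ: joined to p, to no other point
-- of Orb² P, outside M ∪ Orb² M, and outside Orb² of the earlier choices, so that
-- distinct private neighbours are never related by a' = g'⁻¹(g(a)).  The vertex v
-- is then taken joined to all aₚ and to M ∩ τ⁻¹(1), joined to no other vertex
-- of Orb² {aₚ} ∪ M, and outside Ball M 3.  If admissible g, g' differ at
-- p ∈ P but agree at v, then g'⁻¹(g(aₚ)) is joined to v while lying in the set v
-- was chosen to avoid; applied to (h, h') at x ∈ M and to (h⁻¹, h'⁻¹) at h(x) this
-- gives the splitting property.

open import Defs
open import Data.Nat using (ℕ; zero; suc; _≤_; s≤s)
open import Data.Nat.Properties using (_≟_)
open import Data.Bool using (Bool; true; false)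
import Data.Bool as Bool
open import Data.List using (List; []; _∷_; _++_; map; filter; concatMap; [_])
open import Data.List.Membership.Propositional using (_∈_; _∉_; find)
open import Data.List.Membership.Propositional.Properties
  using (∈-map⁺; ∈-map⁻; ∈-++⁺ˡ; ∈-++⁺ʳ; ∈-++⁻; ∈-filter⁺; ∈-filter⁻; ∈-concatMap⁺)
open import Data.List.Membership.DecPropositional _≟_ using (_∈?_)
open import Data.List.Relation.Unary.Any using (here; there)
import Data.List.Relation.Unary.Any as Any
import Data.List.Relation.Unary.All as All
open import Data.List.Relation.Unary.All.Properties using (¬All⇒Any¬)
open import Data.Product using (∃; _×_; _,_; proj₁; proj₂)
open import Data.Sum using (_⊎_; inj₁; inj₂; [_,_]′)
open import Data.Empty using (⊥)
open import Relation.Nullary using (¬_; Dec; yes; no; ¬?)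
open import Relation.Binary.PropositionalEquality hiding ([_])
open ≡-Reasoning

bool-clash : ∀ {b} → b ≡ true → b ≡ false → ⊥
bool-clash refl ()

disagreement : (f g : ℕ → ℕ) (M : List ℕ) → ¬ (∀ x → x ∈ M → f x ≡ g x) →
               ∃ λ x → x ∈ M × f x ≢ g x
disagreement f g M ¬agree =
  find (¬All⇒Any¬ (λ x → f x ≟ g x) M (λ agree → ¬agree (λ _ x∈M → All.lookup agree x∈M)))

_⁻¹ : {R : Graph} → Aut R → Aut R
_⁻¹ {R} h = record
  { fun = inv h ; inv = fun h ; inv-fun = fun-inv h ; fun-inv = inv-fun h
  ; pres = λ x y → trans (sym (pres h (inv h x) (inv h y))) (cong₂ R (fun-inv h x) (fun-inv h y)) }

inverses-differ : {R : Graph} (h h' : Aut R) → ∀ {x} → fun h x ≢ fun h' x →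
                  inv h (fun h x) ≢ inv h' (fun h x)
inverses-differ h h' {x} hx≢h'x e = hx≢h'x (begin
  fun h x                      ≡⟨ sym (fun-inv h' (fun h x)) ⟩
  fun h' (inv h' (fun h x))    ≡⟨ cong (fun h') (sym e) ⟩
  fun h' (inv h (fun h x))     ≡⟨ cong (fun h') (inv-fun h x) ⟩
  fun h' x                     ∎)

module ExtensionProperty {R : Graph} (rg : IsRandomGraph R) where
  open IsRandomGraph rg

  record Extension (A B X : List ℕ) (v : ℕ) : Set where
    field
      joined    : ∀ x → x ∈ A → R x v ≡ true
      separated : ∀ y → y ∈ B → y ∉ A → R y v ≡ false
      avoids    : ∀ x → x ∈ X → v ≢ x

  -- Take z joined to all of A ∪ X, then v joined to A and not to (B ∖ A) ∪ {z};
  -- v ∉ X because every vertex of X is joined to z and v is not.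
  extend : (A B X : List ℕ) → ∃ (Extension A B X)
  extend A B X = v , record { joined = v-joined ; separated = v-separated ; avoids = v-avoids }
    where
    outside-A : List ℕ
    outside-A = filter (λ y → ¬? (y ∈? A)) B

    z-ext : ∃ λ z → (∀ x → x ∈ A ++ X → R x z ≡ true) × (∀ y → y ∈ [] → R y z ≡ false)
    z-ext = extension (A ++ X) [] (λ _ _ ())

    z : ℕ
    z = proj₁ z-ext

    z-joined : ∀ x → x ∈ A ++ X → R x z ≡ true
    z-joined = proj₁ (proj₂ z-ext)

    disjoint : ∀ x → x ∈ A → x ∈ outside-A ++ [ z ] → ⊥
    disjoint x x∈A x∈ with ∈-++⁻ outside-A x∈
    ... | inj₁ x∈out        = proj₂ (∈-filter⁻ (λ y → ¬? (y ∈? A)) {xs = B} x∈out) x∈A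
    ... | inj₂ (here refl)  = bool-clash (z-joined z (∈-++⁺ˡ x∈A)) (irreflexive z)

    v-ext : ∃ λ v → (∀ x → x ∈ A → R x v ≡ true) × (∀ y → y ∈ outside-A ++ [ z ] → R y v ≡ false)
    v-ext = extension A (outside-A ++ [ z ]) disjoint

    v : ℕ
    v = proj₁ v-ext

    v-joined : ∀ x → x ∈ A → R x v ≡ true
    v-joined = proj₁ (proj₂ v-ext)

    v-separated : ∀ y → y ∈ B → y ∉ A → R y v ≡ false
    v-separated y y∈B y∉A = proj₂ (proj₂ v-ext) y (∈-++⁺ˡ (∈-filter⁺ (λ y → ¬? (y ∈? A)) y∈B y∉A))

    v-avoids : ∀ x → x ∈ X → v ≢ x
    v-avoids x x∈X refl = bool-clash (z-joined v (∈-++⁺ʳ A x∈X))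
      (trans (symmetric v z) (proj₂ (proj₂ v-ext) z (∈-++⁺ʳ outside-A (here refl))))

module Orbits {R : Graph} (K : Aut R → Set) (compact : IsCompact K) where

  Move : (ℕ → ℕ) → Set
  Move s = ∃ λ h → K h × ((s ≡ fun h) ⊎ (s ≡ inv h))

  Admissible : Aut R → Set
  Admissible g = Move (fun g) × Move (inv g)

  admissible : ∀ {h} → K h → Admissible h
  admissible {h} k = (h , k , inj₁ refl) , (h , k , inj₂ refl)

  admissible⁻¹ : ∀ {h} → K h → Admissible (h ⁻¹)
  admissible⁻¹ {h} k = (h , k , inj₂ refl) , (h , k , inj₁ refl)

  AgreesOn : List ℕ → Aut R → Aut R → Set
  AgreesOn F i h = ∀ x → x ∈ F → fun h x ≡ fun i x

  agreesOn-open : ∀ F i → IsOpen (AgreesOn F i)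
  agreesOn-open F i h h≈i = F , λ h' h'≈h x x∈F → trans (h'≈h x x∈F) (h≈i x x∈F)

  inverse-agrees : ∀ {F i h} → AgreesOn (F ++ map (inv i) F) i h →
                   ∀ {x} → x ∈ F → inv h x ≡ inv i x
  inverse-agrees {F} {i} {h} h≈i {x} x∈F = begin
    inv h x                    ≡⟨ cong (inv h) (sym (fun-inv i x)) ⟩
    inv h (fun i (inv i x))    ≡⟨ cong (inv h) (sym (h≈i (inv i x) (∈-++⁺ʳ F (∈-map⁺ (inv i) x∈F)))) ⟩
    inv h (fun h (inv i x))    ≡⟨ inv-fun h (inv i x) ⟩
    inv i x                    ∎

  -- Cover K by {h : h agrees with i on F ∪ i⁻¹(F)} for i ∈ K; a finite subcover
  -- i₁ … iₖ bounds these images by the union of iⱼ(F) and iⱼ⁻¹(F).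
  finite-orbit : (F : List ℕ) → ∃ λ O → ∀ {s x} → Move s → x ∈ F → s x ∈ O
  finite-orbit F = concatMap images cover , in-orbit
    where
    window : Aut R → List ℕ
    window i = F ++ map (inv i) F

    images : Aut R → List ℕ
    images i = map (fun i) F ++ map (inv i) F

    subcover : ∃ λ is → ∀ h → K h → Any.Any (λ i → AgreesOn (window i) i h) is
    subcover = compact (λ i → AgreesOn (window i) i) (λ i → agreesOn-open (window i) i)
                       (λ h _ → h , λ _ _ → refl)

    cover : List (Aut R)
    cover = proj₁ subcover

    in-orbit : ∀ {s x} → Move s → x ∈ F → s x ∈ concatMap images cover
    in-orbit {x = x} (h , k , inj₁ refl) x∈F = ∈-concatMap⁺ images (Any.map
      (λ {i} h≈i → subst (_∈ images i) (sym (h≈i x (∈-++⁺ˡ x∈F))) (∈-++⁺ˡ (∈-map⁺ (fun i) x∈F)))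
      (proj₂ subcover h k))
    in-orbit {x = x} (h , k , inj₂ refl) x∈F = ∈-concatMap⁺ images (Any.map
      (λ {i} h≈i → subst (_∈ images i) (sym (inverse-agrees {F} {i} {h} h≈i x∈F))
                         (∈-++⁺ʳ (map (fun i) F) (∈-map⁺ (inv i) x∈F)))
      (proj₂ subcover h k))

  Orb : List ℕ → List ℕ
  Orb F = proj₁ (finite-orbit F)

  orb : ∀ {F s x} → Move s → x ∈ F → s x ∈ Orb F
  orb {F} = proj₂ (finite-orbit F)

  Orb² : List ℕ → List ℕ
  Orb² F = Orb (Orb F)

  orb² : ∀ {F s s' x} → Move s → Move s' → x ∈ F → s' (s x) ∈ Orb² F
  orb² m m' x∈F = orb m' (orb m x∈F)

  Ball : List ℕ → ℕ → List ℕ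
  Ball F zero    = F
  Ball F (suc n) = Ball F n ++ Orb (Ball F n)

  centre-in-ball : ∀ {F x} n → x ∈ F → x ∈ Ball F n
  centre-in-ball zero    x∈F = x∈F
  centre-in-ball (suc n) x∈F = ∈-++⁺ˡ (centre-in-ball n x∈F)

  -- An E-step into Ball F n comes from Orb (Ball F n), by the inverse move.
  walk-in-ball : ∀ {F m n x y} → Walk K m x y → y ∈ F → m ≤ n → x ∈ Ball F n
  walk-in-ball {n = n} (here _) y∈F _ = centre-in-ball n y∈F
  walk-in-ball {F} {n = suc n} (step {x = x} (h , k , inj₁ hx≡y) w) y∈F (s≤s m≤n) =
    ∈-++⁺ʳ (Ball F n) (subst (_∈ Orb (Ball F n)) (trans (cong (inv h) (sym hx≡y)) (inv-fun h x))
                             (orb (h , k , inj₂ refl) (walk-in-ball w y∈F m≤n)))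
  walk-in-ball {F} {n = suc n} (step {x = x} (h , k , inj₂ h⁻¹x≡y) w) y∈F (s≤s m≤n) =
    ∈-++⁺ʳ (Ball F n) (subst (_∈ Orb (Ball F n)) (trans (cong (fun h) (sym h⁻¹x≡y)) (fun-inv h x))
                             (orb (h , k , inj₁ refl) (walk-in-ball w y∈F m≤n)))

  outside-ball : ∀ {F v} n → (∀ x → x ∈ Ball F n → v ≢ x) → DistToSetGt K v F n
  outside-ball n avoids y y∈F (m , m≤n , w) = avoids _ (walk-in-ball w y∈F m≤n) refl

  Separated : ℕ → ℕ → Set
  Separated a b = ∀ g g' → Admissible g → Admissible g' → b ≢ inv g' (fun g a)

  separated-sym : ∀ {a b} → Separated a b → Separated b a
  separated-sym {a} {b} sep g g' adm adm' a≡ = sep g' g adm' adm (begin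
    b                               ≡⟨ sym (inv-fun g b) ⟩
    inv g (fun g b)                 ≡⟨ cong (inv g) (sym (fun-inv g' (fun g b))) ⟩
    inv g (fun g' (inv g' (fun g b))) ≡⟨ cong (λ t → inv g (fun g' t)) (sym a≡) ⟩
    inv g (fun g' a)                ∎)

  separated-from : ∀ {F a b} → b ∈ F → a ∉ Orb² F → Separated b a
  separated-from {F} b∈F a∉ g g' (m , _) (_ , m'⁻¹) a≡ =
    a∉ (subst (_∈ Orb² F) (sym a≡) (orb² m m'⁻¹ b∈F))

module Construction {R : Graph} (rg : IsRandomGraph R) (K : Aut R → Set) (compact : IsCompact K)
                    (M : List ℕ) (τ : ℕ → Bool) where
  open ExtensionProperty rg
  open Orbits K compact

  P : List ℕ
  P = M ++ Orb M

  record PrivateNeighbour (p a : ℕ) : Set where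
    field
      joined    : R p a ≡ true
      isolated  : ∀ w → w ∈ Orb² P → w ≢ p → R w a ≡ false
      off-M     : a ∉ M
      off-Orb²M : a ∉ Orb² M

  choices : List (ℕ × ℕ) → List ℕ
  choices L = map proj₂ L

  fresh : (p : ℕ) (L : List (ℕ × ℕ)) →
          ∃ (Extension [ p ] (Orb² P) (M ++ Orb² M ++ Orb² (choices L)))
  fresh p L = extend [ p ] (Orb² P) (M ++ Orb² M ++ Orb² (choices L))

  fresh-private : ∀ p L → PrivateNeighbour p (proj₁ (fresh p L))
  fresh-private p L = record
    { joined    = joined p (here refl)
    ; isolated  = λ w w∈ w≢p → separated w w∈ (λ { (here w≡p) → w≢p w≡p })
    ; off-M     = λ a∈M → avoids _ (∈-++⁺ˡ a∈M) refl
    ; off-Orb²M = λ a∈ → avoids _ (∈-++⁺ʳ M (∈-++⁺ˡ a∈)) refl }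
    where open Extension (proj₂ (fresh p L))

  fresh-new : ∀ p L → proj₁ (fresh p L) ∉ Orb² (choices L)
  fresh-new p L a∈ = Extension.avoids (proj₂ (fresh p L)) _ (∈-++⁺ʳ M (∈-++⁺ʳ (Orb² M) a∈)) refl

  neighbours : List ℕ → List (ℕ × ℕ)
  neighbours []       = []
  neighbours (p ∷ ps) = (p , proj₁ (fresh p (neighbours ps))) ∷ neighbours ps

  neighbour-exists : ∀ ps {p} → p ∈ ps → ∃ λ a → (p , a) ∈ neighbours ps
  neighbour-exists (p ∷ ps) (here refl) = _ , here refl
  neighbour-exists (p ∷ ps) (there p∈) = let a , pa = neighbour-exists ps p∈ in a , there pa

  neighbour-private : ∀ ps {p a} → (p , a) ∈ neighbours ps → PrivateNeighbour p a
  neighbour-private (p ∷ ps) (here refl) = fresh-private p (neighbours ps)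
  neighbour-private (p ∷ ps) (there pa)  = neighbour-private ps pa

  neighbour-separated : ∀ ps {p a q b} → (p , a) ∈ neighbours ps → (q , b) ∈ neighbours ps →
                        p ≢ q → Separated a b
  neighbour-separated (p ∷ ps) (here refl) (here refl) p≢p = λ _ _ _ _ _ → p≢p refl
  neighbour-separated (p ∷ ps) (here refl) (there qb) _ =
    separated-sym (separated-from (∈-map⁺ proj₂ qb) (fresh-new p (neighbours ps)))
  neighbour-separated (p ∷ ps) (there pa) (here refl) _ =
    separated-from (∈-map⁺ proj₂ pa) (fresh-new p (neighbours ps))
  neighbour-separated (p ∷ ps) (there pa) (there qb) p≢q = neighbour-separated ps pa qb p≢q

  L : List (ℕ × ℕ)
  L = neighbours P

  A : List ℕ
  A = choices L

  owner : ∀ {a} → a ∈ A → ∃ λ q → (q , a) ∈ L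
  owner a∈A with ∈-map⁻ proj₂ a∈A
  ... | (q , a) , qa , refl = q , qa

  A-off-M : ∀ {m} → m ∈ M → m ∉ A
  A-off-M m∈M m∈A = PrivateNeighbour.off-M (neighbour-private P (proj₂ (owner m∈A))) m∈M

  is-positive : ∀ w → Dec (τ w ≡ true)
  is-positive w = τ w Bool.≟ true

  positive : List ℕ
  positive = filter is-positive M

  vertex : ∃ (Extension (A ++ positive) (Orb² A ++ M) (Ball M 3))
  vertex = extend (A ++ positive) (Orb² A ++ M) (Ball M 3)

  v : ℕ
  v = proj₁ vertex

  module V = Extension (proj₂ vertex)

  realizes : Realizes R M τ v
  realizes w w∈M with τ w in τw
  ... | true  = V.joined w (∈-++⁺ʳ A (∈-filter⁺ is-positive w∈M τw))
  ... | false = V.separated w (∈-++⁺ʳ (Orb² A) w∈M) w∉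
    where
    w∉ : w ∉ A ++ positive
    w∉ w∈ with ∈-++⁻ A w∈
    ... | inj₁ w∈A   = A-off-M w∈M w∈A
    ... | inj₂ w∈pos = bool-clash (proj₂ (∈-filter⁻ is-positive {xs = M} w∈pos)) τw

  far : DistToSetGt K v M 3
  far = outside-ball 3 V.avoids

  -- With a = aₚ the vertex
  -- f = g'⁻¹(g(a)) is joined to v, since a is; but f ∈ Orb² A and f ∉ A ∪ positive,
  -- so v was chosen not joined to f.
  differ-at-v : ∀ g g' → Admissible g → Admissible g' → ∀ {p} → p ∈ P →
                fun g p ≢ fun g' p → fun g v ≢ fun g' v
  differ-at-v g g' adm adm' {p} p∈P gp≢g'p gv≡g'v = bool-clash f-joined f-not-joined
    where
    a : ℕ
    a = proj₁ (neighbour-exists P p∈P)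

    pa : (p , a) ∈ L
    pa = proj₂ (neighbour-exists P p∈P)

    a∈A : a ∈ A
    a∈A = ∈-map⁺ proj₂ pa

    module Nₚ = PrivateNeighbour (neighbour-private P pa)

    f : ℕ
    f = inv g' (fun g a)

    g'f≡ga : fun g' f ≡ fun g a
    g'f≡ga = fun-inv g' (fun g a)

    f-joined : R f v ≡ true
    f-joined = begin
      R f v                    ≡⟨ sym (pres g' f v) ⟩
      R (fun g' f) (fun g' v)  ≡⟨ cong₂ R g'f≡ga (sym gv≡g'v) ⟩
      R (fun g a) (fun g v)    ≡⟨ pres g a v ⟩
      R a v                    ≡⟨ V.joined a (∈-++⁺ˡ a∈A) ⟩
      true                     ∎

    -- y = g'⁻¹(g(p)) ≠ p is joined to f, so f is no private neighbour of p;
    -- and f is no private neighbour of q ≠ p by separation.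
    y : ℕ
    y = inv g' (fun g p)

    y-joined : R y f ≡ true
    y-joined = trans (pres (g' ⁻¹) (fun g p) (fun g a)) (trans (pres g p a) Nₚ.joined)

    y≢p : y ≢ p
    y≢p y≡p = gp≢g'p (trans (sym (fun-inv g' (fun g p))) (cong (fun g') y≡p))

    f∉A : f ∉ A
    f∉A f∈A with owner f∈A
    ... | q , qf with p ≟ q
    ...   | no p≢q  = neighbour-separated P pa qf p≢q g g' adm adm' refl
    ...   | yes refl = bool-clash y-joined
      (PrivateNeighbour.isolated (neighbour-private P qf) y (orb² (proj₁ adm) (proj₂ adm') p∈P) y≢p)

    -- f ∈ M would put a = g⁻¹(g'(f)) in Orb² M.
    f∉M : f ∉ M
    f∉M f∈M = Nₚ.off-Orb²M
      (subst (_∈ Orb² M) (trans (cong (inv g) g'f≡ga) (inv-fun g a)) (orb² (proj₁ adm') (proj₂ adm) f∈M))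

    f-not-joined : R f v ≡ false
    f-not-joined = V.separated f (∈-++⁺ˡ (orb² (proj₁ adm) (proj₂ adm') a∈A)) λ f∈ →
      [ f∉A , (λ f∈pos → f∉M (proj₁ (∈-filter⁻ is-positive {xs = M} f∈pos))) ]′ (∈-++⁻ A f∈)

  -- If h, h' ∈ K differ at x ∈ M, use (h, h') at x and (h⁻¹, h'⁻¹) at h(x) ∈ Orb M.
  splitting : SplittingPoint K M v
  splitting h h' k k' ¬agree with disagreement (fun h) (fun h') M ¬agree
  ... | x , x∈M , hx≢h'x =
    differ-at-v h h' (admissible k) (admissible k') (∈-++⁺ˡ x∈M) hx≢h'x ,
    differ-at-v (h ⁻¹) (h' ⁻¹) (admissible⁻¹ k) (admissible⁻¹ k')
                (∈-++⁺ʳ M (orb (h , k , inj₁ refl) x∈M)) (inverses-differ h h' hx≢h'x)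

corollary2p8 : (R : Graph) → IsRandomGraph R →
    (K : Aut R → Set) → IsCompact K →
    (M : List ℕ) → (τ : ℕ → Bool) →
    ∃ λ v → SplittingPoint K M v × Realizes R M τ v × DistToSetGt K v M 3
corollary2p8 R rg K compact M τ = v , splitting , realizes , far
  where open Construction rg K compact M τ
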